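{- Let $n\geq 2$ be an integer. If $G$ is a balanced bipartite graph with partite sets $A$ and $B$, $|A|=|B|=n$ (so $G$ has order $2n\geq 4$), and $G$ has at most $2n$ edges, then $\tilde{\alpha}(G)\geq \frac{n-2}{3}$.
   Context: All graphs are finite, simple and undirected. A bipartite graph $G$ is always considered with a fixed bipartition into partite sets $A$ and $B$; it is balanced if $|A|=|B|$. A bihole of order $k$ in $G$ is an independent set $I$ of $G$ with $|I\cap A|=|I\cap B|=k$. $\tilde{\alpha}(G)$ denotes the largest order of a bihole in $G$. -}

module Defs where

open import Data.Nat using (ℕ; _+_)
open import Data.Bool using (Bool; true; false)
open import Data.Fin using (Fin)
open import Data.Fin.Subset using (Subset; _∈_; ∣_∣)
open import Data.List using (List; map; length; filter)
open import Data.Nat.ListAction using (sum)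
open import Data.Fin.Base using ()
open import Data.List.Base using (allFin)
open import Data.Product using (Σ; _×_; _,_)
open import Relation.Binary.PropositionalEquality using (_≡_)
open import Relation.Nullary using (¬_)
open import Relation.Nullary.Decidable using (Dec)
open import Data.Bool using (T; T?)

-- A (simple) bipartite graph with fixed partite sets A = Fin a and B = Fin b,
-- given by its biadjacency matrix: adj i j = true iff i ∈ A is adjacent to j ∈ B.
-- (A bipartite graph has no edges inside A or inside B.)
record BipGraph (a b : ℕ) : Set where
  field
    adj : Fin a → Fin b → Bool
open BipGraph public

edgeCount : ∀ {a b} → BipGraph a b → ℕ
edgeCount {a} {b} G =
  sum (map (λ i → length (filter (λ j → T? (adj G i j)) (allFin b))) (allFin a))

Independent : ∀ {a b} → BipGraph a b → Subset a → Subset b → Set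
Independent G S T' = ∀ i j → i ∈ S → j ∈ T' → adj G i j ≡ false

IsBihole : ∀ {a b} → BipGraph a b → Subset a → Subset b → ℕ → Set
IsBihole G S T' k = Independent G S T' × ∣ S ∣ ≡ k × ∣ T' ∣ ≡ k

HasBihole : ∀ {a b} → BipGraph a b → ℕ → Set
HasBihole {a} {b} G k = Σ (Subset a) λ S → Σ (Subset b) λ T' → IsBihole G S T' k

-- At most 2n/3 vertices of A have degree at least 3, so at least n/3 of them have
-- degree at most 2. Take k = ⌊n/3⌋ of these as S; together they have at most 2k
-- neighbours in B, so at least n - 2k ≥ k vertices of B are non-adjacent to all of S,
-- and k of them complete S to a bihole of order k.
module Submission where

open import Defs
open import Data.Nat using (ℕ; _≤_; _*_; _+_)
open import Data.Product using (Σ; _×_)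
open import Data.Nat using (zero; suc; z≤n; s≤s; _≤?_)
open import Data.Nat.DivMod using (_/_; _%_; m≡m%n+[m/n]*n; m%n<n; m/n*n≤m)
open import Data.Nat.Properties
open import Data.Bool using (true; false; T; T?)
open import Data.Fin using (Fin; zero; suc)
open import Data.Fin.Subset using (Subset; _∈_; _⊆_; ∣_∣; ⊥; ∁; _∪_; inside; outside)
open import Data.Fin.Subset.Properties
  using (⊥⊆; ∣⊥∣≡0; ∣p∣≤n; ∣p∣≤∣x∷p∣; ∣∁p∣≡n∸∣p∣; x∈∁p⇒x∉p; p⊆p∪q; q⊆p∪q; ⊆-trans)
import Data.List as List
import Data.Nat.ListAction as ListAction
open import Data.Vec using ([]; _∷_; here; there; tabulate; sum)
open import Data.Vec.Properties using (tabulate-cong)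
open import Data.Product using (_,_)
open import Data.Unit using (tt)
open import Function using (_∘_; id)
open import Level using (Level)
open import Relation.Nullary using (yes; no; does; contradiction)
open import Relation.Unary using (Pred; Decidable)
open import Relation.Binary.PropositionalEquality

private
  variable
    ℓ : Level
    A : Set
    a b n : ℕ

subsetOf : {P : Pred (Fin n) ℓ} → Decidable P → Subset n
subsetOf P? = tabulate (does ∘ P?)

∈-subsetOf⁻ : {P : Pred (Fin n) ℓ} (P? : Decidable P) {i : Fin n} → i ∈ subsetOf P? → P i
∈-subsetOf⁻ P? {zero} i∈ with P? zero
... | yes p = p
∈-subsetOf⁻ P? {zero} () | no _
∈-subsetOf⁻ P? {suc i} (there i∈) = ∈-subsetOf⁻ (P? ∘ suc) i∈

∈-subsetOf⁺ : {P : Pred (Fin n) ℓ} (P? : Decidable P) {i : Fin n} → P i → i ∈ subsetOf P?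
∈-subsetOf⁺ P? {zero} p with P? zero
... | yes _ = here
... | no ¬p = contradiction p ¬p
∈-subsetOf⁺ P? {suc i} p = there (∈-subsetOf⁺ (P? ∘ suc) p)

length-filter-tabulate : {P : Pred A ℓ} (P? : Decidable P) (f : Fin n → A) →
  List.length (List.filter P? (List.tabulate f)) ≡ ∣ subsetOf (P? ∘ f) ∣
length-filter-tabulate {n = zero} P? f = refl
length-filter-tabulate {n = suc n} P? f with P? (f zero)
... | yes _ = cong suc (length-filter-tabulate P? (f ∘ suc))
... | no _ = length-filter-tabulate P? (f ∘ suc)

sum-map-tabulate : (g : A → ℕ) (f : Fin n → A) →
  ListAction.sum (List.map g (List.tabulate f)) ≡ sum (tabulate (g ∘ f))
sum-map-tabulate {n = zero} g f = refl
sum-map-tabulate {n = suc n} g f = cong (g (f zero) +_) (sum-map-tabulate g (f ∘ suc))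

∣p∣+∣∁p∣≡n : (p : Subset n) → ∣ p ∣ + ∣ ∁ p ∣ ≡ n
∣p∣+∣∁p∣≡n p = trans (cong (∣ p ∣ +_) (∣∁p∣≡n∸∣p∣ p)) (m+[n∸m]≡n (∣p∣≤n p))

∣p∪q∣≤∣p∣+∣q∣ : (p q : Subset n) → ∣ p ∪ q ∣ ≤ ∣ p ∣ + ∣ q ∣
∣p∪q∣≤∣p∣+∣q∣ [] [] = z≤n
∣p∪q∣≤∣p∣+∣q∣ (inside ∷ p) (t ∷ q) =
  s≤s (≤-trans (∣p∪q∣≤∣p∣+∣q∣ p q) (+-monoʳ-≤ ∣ p ∣ (∣p∣≤∣x∷p∣ t q)))
∣p∪q∣≤∣p∣+∣q∣ (outside ∷ p) (inside ∷ q) =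
  ≤-trans (s≤s (∣p∪q∣≤∣p∣+∣q∣ p q)) (≤-reflexive (sym (+-suc ∣ p ∣ ∣ q ∣)))
∣p∪q∣≤∣p∣+∣q∣ (outside ∷ p) (outside ∷ q) = ∣p∪q∣≤∣p∣+∣q∣ p q

∷-⊆ : ∀ {s} {p q : Subset n} → p ⊆ q → s ∷ p ⊆ s ∷ q
∷-⊆ p⊆q here = here
∷-⊆ p⊆q (there i∈p) = there (p⊆q i∈p)

⊆-ofSize : ∀ {k} (p : Subset n) → k ≤ ∣ p ∣ → Σ (Subset n) λ q → q ⊆ p × ∣ q ∣ ≡ k
⊆-ofSize {n} {zero} p _ = ⊥ , ⊥⊆ , ∣⊥∣≡0 n
⊆-ofSize {k = suc k} (inside ∷ p) (s≤s k≤∣p∣) with ⊆-ofSize p k≤∣p∣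
... | q , q⊆p , ∣q∣≡k = inside ∷ q , ∷-⊆ q⊆p , cong suc ∣q∣≡k
⊆-ofSize {k = suc k} (outside ∷ p) k≤∣p∣ with ⊆-ofSize p k≤∣p∣
... | q , q⊆p , ∣q∣≡k = outside ∷ q , ∷-⊆ q⊆p , ∣q∣≡k

atMost : ℕ → (Fin n → ℕ) → Subset n
atMost d f = subsetOf (λ i → f i ≤? d)

-- Stated for an arbitrary decision procedure: `does (f i ≤? d)` computes to `f i ≤ᵇ d`,
-- so a `with` on `f zero ≤? d` could not abstract it out of the goal.
[1+d]*∣∁subsetOf∣≤sum : ∀ d (f : Fin n → ℕ) (≤d? : Decidable (λ i → f i ≤ d)) →
  suc d * ∣ ∁ (subsetOf ≤d?) ∣ ≤ sum (tabulate f)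
[1+d]*∣∁subsetOf∣≤sum {zero} d f ≤d? = ≤-reflexive (*-zeroʳ d)
[1+d]*∣∁subsetOf∣≤sum {suc n} d f ≤d? with ≤d? zero
... | yes _ = ≤-trans ([1+d]*∣∁subsetOf∣≤sum d (f ∘ suc) (≤d? ∘ suc)) (m≤n+m _ (f zero))
... | no f₀≰d = begin
  suc d * suc ∣ ∁ (subsetOf (≤d? ∘ suc)) ∣       ≡⟨ *-suc (suc d) _ ⟩
  suc d + suc d * ∣ ∁ (subsetOf (≤d? ∘ suc)) ∣   ≤⟨ +-mono-≤ (≰⇒> f₀≰d) ([1+d]*∣∁subsetOf∣≤sum d (f ∘ suc) (≤d? ∘ suc)) ⟩
  f zero + sum (tabulate (f ∘ suc))               ∎
  where open ≤-Reasoning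

n≤[1+d]*∣atMost∣ : ∀ d (f : Fin n → ℕ) → sum (tabulate f) ≤ d * n → n ≤ suc d * ∣ atMost d f ∣
n≤[1+d]*∣atMost∣ {n} d f Σf≤dn = +-cancelʳ-≤ (d * n) n (suc d * ∣ L ∣) (begin
  suc d * n                          ≡⟨ cong (suc d *_) (∣p∣+∣∁p∣≡n L) ⟨
  suc d * (∣ L ∣ + ∣ ∁ L ∣)            ≡⟨ *-distribˡ-+ (suc d) ∣ L ∣ ∣ ∁ L ∣ ⟩
  suc d * ∣ L ∣ + suc d * ∣ ∁ L ∣      ≤⟨ +-monoʳ-≤ (suc d * ∣ L ∣) (≤-trans ([1+d]*∣∁subsetOf∣≤sum d f (λ i → f i ≤? d)) Σf≤dn) ⟩
  suc d * ∣ L ∣ + d * n              ∎)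
  where
  open ≤-Reasoning
  L : Subset n
  L = atMost d f

⋃[_]_ : Subset a → (Fin a → Subset b) → Subset b
⋃[ [] ] R = ⊥
⋃[ inside ∷ S ] R = R zero ∪ ⋃[ S ] (R ∘ suc)
⋃[ outside ∷ S ] R = ⋃[ S ] (R ∘ suc)

⊆-⋃[] : (S : Subset a) (R : Fin a → Subset b) {i : Fin a} → i ∈ S → R i ⊆ ⋃[ S ] R
⊆-⋃[] (inside ∷ S) R here = p⊆p∪q _
⊆-⋃[] (inside ∷ S) R (there i∈S) = ⊆-trans (⊆-⋃[] S (R ∘ suc) i∈S) (q⊆p∪q (R zero) _)
⊆-⋃[] (outside ∷ S) R (there i∈S) = ⊆-⋃[] S (R ∘ suc) i∈S

∣⋃[]∣≤ : ∀ d (S : Subset a) (R : Fin a → Subset b) →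
  (∀ {i} → i ∈ S → ∣ R i ∣ ≤ d) → ∣ ⋃[ S ] R ∣ ≤ d * ∣ S ∣
∣⋃[]∣≤ {b = b} d [] R _ = ≤-reflexive (trans (∣⊥∣≡0 b) (sym (*-zeroʳ d)))
∣⋃[]∣≤ d (inside ∷ S) R ∣R∣≤d = begin
  ∣ R zero ∪ ⋃[ S ] (R ∘ suc) ∣       ≤⟨ ∣p∪q∣≤∣p∣+∣q∣ (R zero) _ ⟩
  ∣ R zero ∣ + ∣ ⋃[ S ] (R ∘ suc) ∣   ≤⟨ +-mono-≤ (∣R∣≤d here) (∣⋃[]∣≤ d S (R ∘ suc) (∣R∣≤d ∘ there)) ⟩
  d + d * ∣ S ∣                       ≡⟨ *-suc d ∣ S ∣ ⟨
  d * suc ∣ S ∣                       ∎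
  where open ≤-Reasoning
∣⋃[]∣≤ d (outside ∷ S) R ∣R∣≤d = ∣⋃[]∣≤ d S (R ∘ suc) (∣R∣≤d ∘ there)

neighbours : BipGraph a b → Fin a → Subset b
neighbours G i = subsetOf (λ j → T? (adj G i j))

degree : BipGraph a b → Fin a → ℕ
degree G i = ∣ neighbours G i ∣

edgeCount≡sum-degree : (G : BipGraph a b) → edgeCount G ≡ sum (tabulate (degree G))
edgeCount≡sum-degree {b = b} G = trans
  (sum-map-tabulate (λ i → List.length (List.filter (λ j → T? (adj G i j)) (List.allFin b))) id)
  (cong sum (tabulate-cong (λ i → length-filter-tabulate (λ j → T? (adj G i j)) id)))

⊆∁⋃neighbours⇒Independent : (G : BipGraph a b) (S : Subset a) {U : Subset b} →
  U ⊆ ∁ (⋃[ S ] neighbours G) → Independent G S U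
⊆∁⋃neighbours⇒Independent G S U⊆ i j i∈S j∈U with adj G i j in eq
... | false = refl
... | true = contradiction
  (⊆-⋃[] S (neighbours G) i∈S (∈-subsetOf⁺ (λ j → T? (adj G i j)) (subst T (sym eq) tt)))
  (x∈∁p⇒x∉p (U⊆ j∈U))

boundedDegree⇒HasBihole : (G : BipGraph a b) (d : ℕ) (S : Subset a) →
  (∀ {i} → i ∈ S → degree G i ≤ d) → ∣ S ∣ + d * ∣ S ∣ ≤ b → HasBihole G ∣ S ∣
boundedDegree⇒HasBihole {b = b} G d S deg≤d room =
  let U , U⊆∁N , ∣U∣≡∣S∣ = ⊆-ofSize (∁ N) ∣S∣≤∣∁N∣
  in S , U , ⊆∁⋃neighbours⇒Independent G S U⊆∁N , refl , ∣U∣≡∣S∣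
  where
  N : Subset b
  N = ⋃[ S ] neighbours G
  ∣S∣≤∣∁N∣ : ∣ S ∣ ≤ ∣ ∁ N ∣
  ∣S∣≤∣∁N∣ = +-cancelˡ-≤ (d * ∣ S ∣) ∣ S ∣ ∣ ∁ N ∣ (begin
    d * ∣ S ∣ + ∣ S ∣    ≡⟨ +-comm (d * ∣ S ∣) ∣ S ∣ ⟩
    ∣ S ∣ + d * ∣ S ∣    ≤⟨ room ⟩
    b                  ≡⟨ ∣p∣+∣∁p∣≡n N ⟨
    ∣ N ∣ + ∣ ∁ N ∣      ≤⟨ +-monoˡ-≤ ∣ ∁ N ∣ (∣⋃[]∣≤ d S (neighbours G) deg≤d) ⟩
    d * ∣ S ∣ + ∣ ∁ N ∣  ∎)
    where open ≤-Reasoning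

m≤[1+d]*[m/[1+d]]+d : ∀ m d → m ≤ suc d * (m / suc d) + d
m≤[1+d]*[m/[1+d]]+d m d = begin
  m                              ≡⟨ m≡m%n+[m/n]*n m (suc d) ⟩
  m % suc d + m / suc d * suc d  ≤⟨ +-monoˡ-≤ _ (≤-pred (m%n<n m (suc d))) ⟩
  d + m / suc d * suc d          ≡⟨ +-comm d _ ⟩
  m / suc d * suc d + d          ≡⟨ cong (_+ d) (*-comm (m / suc d) (suc d)) ⟩
  suc d * (m / suc d) + d        ∎
  where open ≤-Reasoning

-- The bound holds for every n.
proposition6 : (n : ℕ) → 2 ≤ n → (G : BipGraph n n) → edgeCount G ≤ 2 * n →
    Σ ℕ (λ k → HasBihole G k × n ≤ 3 * k + 2)
proposition6 n _ G edges≤2n =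
  let S , S⊆L , ∣S∣≡k = ⊆-ofSize L (*-cancelˡ-≤ 3 (≤-trans 3k≤n n≤3∣L∣))
      deg≤2 : ∀ {i} → i ∈ S → degree G i ≤ 2
      deg≤2 i∈S = ∈-subsetOf⁻ (λ i → degree G i ≤? 2) (S⊆L i∈S)
  in k
   , subst (HasBihole G) ∣S∣≡k
       (boundedDegree⇒HasBihole G 2 S deg≤2 (subst (λ s → 3 * s ≤ n) (sym ∣S∣≡k) 3k≤n))
   , m≤[1+d]*[m/[1+d]]+d n 2
  where
  k : ℕ
  k = n / 3
  3k≤n : 3 * k ≤ n
  3k≤n = subst (_≤ n) (*-comm k 3) (m/n*n≤m n 3)
  L : Subset n
  L = atMost 2 (degree G)
  n≤3∣L∣ : n ≤ 3 * ∣ L ∣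
  n≤3∣L∣ = n≤[1+d]*∣atMost∣ 2 (degree G) (subst (_≤ 2 * n) (edgeCount≡sum-degree G) edges≤2n)
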